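{- Fix a positive integer $m$. The sequence $(|s^{n-m}(S_n)|)_{n\geq m}$ is nonincreasing.
   Context: $S_n$ is the set of permutations of $\{1,\ldots,n\}$ in one-line notation. West's stack-sorting map $s$ is defined recursively: $s$ sends the empty permutation to itself, and for a nonempty permutation $\pi=LmR$ with $m$ its largest entry, $s(\pi)=s(L)\,s(R)\,m$; $s^t$ is the $t$-fold iterate and $s^t(S_n)$ its image on $S_n$. -}

module Defs where

open import Data.Nat using (ℕ; zero; suc; _⊔_; _≡ᵇ_; _<_)
open import Data.Nat.Properties using (_≟_)
open import Data.List using (List; []; _∷_; _++_; length; concatMap; filter; map; foldr)
open import Data.Bool.ListAction using (any)
open import Data.Product using (_×_; _,_)
open import Data.Bool using (Bool; true; false)
open import Function using (_∘_)

-- Permutations of {1,…,n} in one-line notation are lists of naturals.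

-- maximum entry of a list (0 for the empty list; entries are ≥ 1)
maxList : List ℕ → ℕ
maxList = foldr _⊔_ 0

splitAt : ℕ → List ℕ → List ℕ × List ℕ
splitAt m [] = [] , []
splitAt m (x ∷ xs) with x ≡ᵇ m
... | true  = [] , xs
... | false with splitAt m xs
...   | (L , R) = x ∷ L , R

-- West's stack-sorting map, with fuel (recursion depth bounded by length)
-- s(∅) = ∅, s(L m R) = s(L) s(R) m where m is the largest entry.
sFuel : ℕ → List ℕ → List ℕ
sFuel zero π = π
sFuel (suc k) [] = []
sFuel (suc k) π@(_ ∷ _) with splitAt (maxList π) π
... | (L , R) = sFuel k L ++ sFuel k R ++ (maxList π ∷ [])

-- fuel = length π suffices, since L and R are strictly shorter than π
s : List ℕ → List ℕ
s π = sFuel (length π) π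

sIter : ℕ → List ℕ → List ℕ
sIter zero π = π
sIter (suc t) π = s (sIter t π)

insertions : ℕ → List ℕ → List (List ℕ)
insertions x [] = (x ∷ []) ∷ []
insertions x (y ∷ ys) = (x ∷ y ∷ ys) ∷ map (y ∷_) (insertions x ys)

perms : ℕ → List (List ℕ)
perms zero = [] ∷ []
perms (suc n) = concatMap (insertions (suc n)) (perms n)

-- S_n as a list (without repetitions) of permutations of {1,…,n}
S : ℕ → List (List ℕ)
S = perms

open import Data.List.Properties using (≡-dec)
open import Relation.Nullary.Decidable using (⌊_⌋)
open import Data.Bool using (T?)

_≟L_ = ≡-dec _≟_

-- |s^t(S_n)| : the number of σ ∈ S_n lying in the image s^t(S_n)
imageSize : ℕ → ℕ → ℕ
imageSize t n = length (filter (λ σ → T? (any (λ π → ⌊ sIter t π ≟L σ ⌋) (S n))) (S n))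

-- The stack-sorting map puts the largest entry last, and s (π ∷ʳ M) ≡ s π ∷ʳ M
-- whenever M exceeds every entry of π. So for τ ∈ S (n+1) we may write
-- s τ = ρ ∷ʳ (n+1) with ρ ∈ S n, and then s^(t+1) τ = s^t ρ ∷ʳ (n+1). Hence
-- σ ∷ʳ (n+1) ↦ σ injects s^(t+1)(S (n+1)) into s^t(S n), and t = n − m gives the
-- claim.
module Submission where

open import Defs
open import Algebra.Bundles using (CommutativeMonoid)
open import Data.Bool using (true; false; T; T?)
open import Data.Bool.ListAction using (any)
open import Data.Empty using (⊥-elim)
open import Data.List using (List; []; _∷_; _++_; [_]; _∷ʳ_; length; concatMap; map; filter; applyDownFrom)
open import Data.List.Properties using (++-assoc; ++-identityʳ; length-++; ∷-injective; ∷ʳ-injectiveˡ; filter-reject; filter-++)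
open import Data.List.Membership.Propositional using (_∈_; _∉_; find; lose)
open import Data.List.Membership.Propositional.Properties using (∈-map⁺; ∈-map⁻; ∈-++⁺ʳ; ∈-∃++; ∈-concatMap⁺; ∈-concatMap⁻)
open import Data.List.Relation.Unary.All as All using (All; []; _∷_)
open import Data.List.Relation.Unary.All.Properties using (All¬⇒¬Any)
open import Data.List.Relation.Unary.Any using (here; there)
open import Data.List.Relation.Unary.Any.Properties using (any⁺; any⁻)
open import Data.List.Relation.Binary.Permutation.Propositional using (_↭_; refl; prep; swap; ↭-refl; ↭-sym; ↭-trans; ↭-reflexive; ↭⇒↭ₛ; module PermutationReasoning)
open import Data.List.Relation.Binary.Permutation.Propositional.Properties using (++⁺; ++⁺ˡ; ++-comm; drop-mid; All-resp-↭; ∈-resp-↭; ↭-empty-inv)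
open import Data.List.Relation.Binary.Permutation.Setoid.Properties using (foldr-commMonoid)
open import Data.Nat using (ℕ; zero; suc; _⊔_; _≡ᵇ_; _≤_; _<_; _∸_; z≤n)
open import Data.Nat.Properties
open import Data.Sum using (inj₁; inj₂)
open import Data.Product using (_×_; _,_; proj₁; proj₂; ∃)
open import Relation.Binary.PropositionalEquality using (_≡_; _≢_; refl; sym; trans; cong; subst; module ≡-Reasoning)
open import Relation.Nullary using (¬_; yes; no; does)
open import Relation.Nullary.Decidable using (⌊_⌋; toWitness; fromWitness)
open import Relation.Unary using (Pred; Decidable)
open import Function using (_∘_)
open import Level using (0ℓ)

maxList-↭ : ∀ {xs ys} → xs ↭ ys → maxList xs ≡ maxList ys
maxList-↭ p = foldr-commMonoid ⊔-0.setoid ⊔-0.isCommutativeMonoid (↭⇒↭ₛ p)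
  where module ⊔-0 = CommutativeMonoid ⊔-0-commutativeMonoid

maxList-∈ : ∀ x xs → maxList (x ∷ xs) ∈ x ∷ xs
maxList-∈ x [] = here (⊔-identityʳ x)
maxList-∈ x (y ∷ ys) with ⊔-sel x (maxList (y ∷ ys))
... | inj₁ x⊔m≡x = here x⊔m≡x
... | inj₂ x⊔m≡m = there (subst (_∈ y ∷ ys) (sym x⊔m≡m) (maxList-∈ y ys))

maxList-∷ʳ : ∀ {M} π → All (_< M) π → maxList (π ∷ʳ M) ≡ M
maxList-∷ʳ []       _          = ⊔-identityʳ _
maxList-∷ʳ (x ∷ xs) (x<M ∷ xs<M) rewrite maxList-∷ʳ xs xs<M = m≤n⇒m⊔n≡n (<⇒≤ x<M)

splitAt-∷ʳ : ∀ {M} π → All (_< M) π → splitAt M (π ∷ʳ M) ≡ (π , [])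
splitAt-∷ʳ {M} [] _ with M ≡ᵇ M in eq
... | true  = refl
... | false = ⊥-elim (subst T eq (≡⇒≡ᵇ M M refl))
splitAt-∷ʳ {M} (x ∷ xs) (x<M ∷ xs<M) with x ≡ᵇ M in eq
... | true  = ⊥-elim (<⇒≢ x<M (≡ᵇ⇒≡ x M (subst T (sym eq) _)))
... | false rewrite splitAt-∷ʳ xs xs<M = refl

splitAt-++-∷ : ∀ {m} π → m ∈ π → proj₁ (splitAt m π) ++ m ∷ proj₂ (splitAt m π) ≡ π
splitAt-++-∷ {m} (x ∷ xs) m∈π with x ≡ᵇ m in eq
... | true = cong (_∷ xs) (sym (≡ᵇ⇒≡ x m (subst T (sym eq) _)))
splitAt-++-∷ {m} (x ∷ xs) (here m≡x)   | false = ⊥-elim (subst T eq (≡⇒≡ᵇ x m (sym m≡x)))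
splitAt-++-∷ {m} (x ∷ xs) (there m∈xs) | false with splitAt m xs | splitAt-++-∷ xs m∈xs
... | _ | xs≡L++m∷R = cong (x ∷_) xs≡L++m∷R

sFuel-unfold : ∀ k x xs {M L R} → maxList (x ∷ xs) ≡ M → splitAt M (x ∷ xs) ≡ (L , R) →
  sFuel (suc k) (x ∷ xs) ≡ sFuel k L ++ sFuel k R ++ [ M ]
sFuel-unfold k x xs refl split with splitAt (maxList (x ∷ xs)) (x ∷ xs)
sFuel-unfold k x xs refl refl | _ = refl

sFuel-[] : ∀ k → sFuel k [] ≡ []
sFuel-[] zero    = refl
sFuel-[] (suc k) = refl

sFuel-↭ : ∀ k π → sFuel k π ↭ π
sFuel-↭ zero    π        = ↭-refl
sFuel-↭ (suc k) []       = ↭-refl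
sFuel-↭ (suc k) (x ∷ xs) = begin
  sFuel (suc k) (x ∷ xs)            ≡⟨ sFuel-unfold k x xs refl refl ⟩
  sFuel k L ++ sFuel k R ++ [ m ]   ↭⟨ ++⁺ (sFuel-↭ k L) (++⁺ (sFuel-↭ k R) ↭-refl) ⟩
  L ++ R ++ [ m ]                   ↭⟨ ++⁺ˡ L (++-comm R [ m ]) ⟩
  L ++ m ∷ R                        ≡⟨ splitAt-++-∷ (x ∷ xs) (maxList-∈ x xs) ⟩
  x ∷ xs                            ∎
  where
  open PermutationReasoning
  m = maxList (x ∷ xs)
  L = proj₁ (splitAt m (x ∷ xs))
  R = proj₂ (splitAt m (x ∷ xs))

sFuel-∷ʳ : ∀ k {M} π → All (_< M) π → sFuel (suc k) (π ∷ʳ M) ≡ sFuel k π ∷ʳ M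
sFuel-∷ʳ k [] π<M
  rewrite sFuel-unfold k _ [] (maxList-∷ʳ [] π<M) (splitAt-∷ʳ [] π<M) | sFuel-[] k = refl
sFuel-∷ʳ k (x ∷ xs) π<M
  rewrite sFuel-unfold k x (xs ∷ʳ _) (maxList-∷ʳ (x ∷ xs) π<M) (splitAt-∷ʳ (x ∷ xs) π<M)
        | sFuel-[] k = refl

s-↭ : ∀ π → s π ↭ π
s-↭ π = sFuel-↭ (length π) π

s-∷ʳ : ∀ {M} π → All (_< M) π → s (π ∷ʳ M) ≡ s π ∷ʳ M
s-∷ʳ {M} π π<M rewrite length-++ π {[ M ]} | +-comm (length π) 1 = sFuel-∷ʳ (length π) π π<M

s-∷ʳ-maxList : ∀ x xs → ∃ λ u → s (x ∷ xs) ≡ u ∷ʳ maxList (x ∷ xs)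
s-∷ʳ-maxList x xs = sFuel k L ++ sFuel k R , (begin
  s (x ∷ xs)                              ≡⟨ sFuel-unfold k x xs refl refl ⟩
  sFuel k L ++ sFuel k R ++ [ m ]         ≡⟨ ++-assoc (sFuel k L) (sFuel k R) [ m ] ⟨
  (sFuel k L ++ sFuel k R) ∷ʳ m           ∎)
  where
  open ≡-Reasoning
  k = length xs
  m = maxList (x ∷ xs)
  L = proj₁ (splitAt m (x ∷ xs))
  R = proj₂ (splitAt m (x ∷ xs))

sIter-↭ : ∀ t π → sIter t π ↭ π
sIter-↭ zero    π = ↭-refl
sIter-↭ (suc t) π = ↭-trans (s-↭ (sIter t π)) (sIter-↭ t π)

sIter-∷ʳ : ∀ t {M} π → All (_< M) π → sIter t (π ∷ʳ M) ≡ sIter t π ∷ʳ M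
sIter-∷ʳ zero    π π<M = refl
sIter-∷ʳ (suc t) π π<M rewrite sIter-∷ʳ t π π<M =
  s-∷ʳ (sIter t π) (All-resp-↭ (↭-sym (sIter-↭ t π)) π<M)

sIter-suc : ∀ t τ → sIter (suc t) τ ≡ sIter t (s τ)
sIter-suc zero    τ = refl
sIter-suc (suc t) τ = cong s (sIter-suc t τ)

applyDownFrom-suc-< : ∀ n → All (_< suc n) (applyDownFrom suc n)
applyDownFrom-suc-< zero    = []
applyDownFrom-suc-< (suc n) = n<1+n (suc n) ∷ All.map m<n⇒m<1+n (applyDownFrom-suc-< n)

maxList-applyDownFrom-suc : ∀ n → maxList (applyDownFrom suc n) ≡ n
maxList-applyDownFrom-suc zero    = refl
maxList-applyDownFrom-suc (suc n) rewrite maxList-applyDownFrom-suc n = m≥n⇒m⊔n≡m (n≤1+n n)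

∈-insertions⁻ : ∀ x p {ω} → ω ∈ insertions x p → ω ↭ x ∷ p
∈-insertions⁻ x []       (here refl) = ↭-refl
∈-insertions⁻ x (y ∷ ys) (here refl) = ↭-refl
∈-insertions⁻ x (y ∷ ys) (there ω∈) with ∈-map⁻ (y ∷_) ω∈
... | ω′ , ω′∈ , refl = ↭-trans (prep y (∈-insertions⁻ x ys ω′∈)) (swap y x ↭-refl)

∈-insertions⁺ : ∀ x L R → L ++ x ∷ R ∈ insertions x (L ++ R)
∈-insertions⁺ x []       []      = here refl
∈-insertions⁺ x []       (_ ∷ _) = here refl
∈-insertions⁺ x (l ∷ L)  R       = there (∈-map⁺ (l ∷_) (∈-insertions⁺ x L R))

∈-S⁻ : ∀ n {π} → π ∈ S n → π ↭ applyDownFrom suc n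
∈-S⁻ zero    (here refl) = ↭-refl
∈-S⁻ (suc n) π∈ with find (∈-concatMap⁻ (insertions (suc n)) {xs = perms n} π∈)
... | p , p∈ , π∈ins = ↭-trans (∈-insertions⁻ (suc n) p π∈ins) (prep (suc n) (∈-S⁻ n p∈))

∈-S⁺ : ∀ n {π} → π ↭ applyDownFrom suc n → π ∈ S n
∈-S⁺ zero    π↭ rewrite ↭-empty-inv π↭ = here refl
∈-S⁺ (suc n) π↭ with ∈-∃++ (∈-resp-↭ (↭-sym π↭) (here refl))
... | L , R , refl = ∈-concatMap⁺ (insertions (suc n))
  (lose (∈-S⁺ n (drop-mid L [] π↭)) (∈-insertions⁺ (suc n) L R))

∈-S⇒< : ∀ n {π} → π ∈ S n → All (_< suc n) π
∈-S⇒< n π∈ = All-resp-↭ (↭-sym (∈-S⁻ n π∈)) (applyDownFrom-suc-< n)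

s-∈-S-suc : ∀ n {τ} → τ ∈ S (suc n) → ∃ λ ρ → ρ ∈ S n × s τ ≡ ρ ∷ʳ suc n
s-∈-S-suc n {τ} τ∈ with τ | ∈-S⁻ (suc n) τ∈
... | []     | τ↭ with () ← ↭-empty-inv (↭-sym τ↭)
... | x ∷ xs | τ↭ with s-∷ʳ-maxList x xs
...   | ρ , sτ≡ρ∷ʳmax = ρ , ∈-S⁺ n ρ↭ , sτ≡
  where
  sτ≡ : s (x ∷ xs) ≡ ρ ∷ʳ suc n
  sτ≡ = trans sτ≡ρ∷ʳmax (cong (ρ ∷ʳ_) (trans (maxList-↭ τ↭) (maxList-applyDownFrom-suc (suc n))))

  ρ↭ : ρ ↭ applyDownFrom suc n
  ρ↭ = ↭-trans (↭-reflexive (sym (++-identityʳ ρ))) (drop-mid ρ [] (begin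
    ρ ∷ʳ suc n                ≡⟨ sτ≡ ⟨
    s (x ∷ xs)                ↭⟨ s-↭ (x ∷ xs) ⟩
    x ∷ xs                    ↭⟨ τ↭ ⟩
    applyDownFrom suc (suc n) ∎))
    where open PermutationReasoning

sIter-∈-S-suc : ∀ t n {τ} → τ ∈ S (suc n) → ∃ λ ρ → ρ ∈ S n × sIter (suc t) τ ≡ sIter t ρ ∷ʳ suc n
sIter-∈-S-suc t n {τ} τ∈ with s-∈-S-suc n τ∈
... | ρ , ρ∈ , sτ≡ = ρ , ρ∈ , (begin
  sIter (suc t) τ     ≡⟨ sIter-suc t τ ⟩
  sIter t (s τ)       ≡⟨ cong (sIter t) sτ≡ ⟩
  sIter t (ρ ∷ʳ suc n) ≡⟨ sIter-∷ʳ t ρ (∈-S⇒< n ρ∈) ⟩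
  sIter t ρ ∷ʳ suc n  ∎)
  where open ≡-Reasoning

InImage : ℕ → ℕ → Pred (List ℕ) 0ℓ
InImage t n σ = T (any (λ π → ⌊ sIter t π ≟L σ ⌋) (S n))

InImage⁻ : ∀ t n {σ} → InImage t n σ → ∃ λ τ → τ ∈ S n × sIter t τ ≡ σ
InImage⁻ t n σ∈ with find (any⁻ _ (S n) σ∈)
... | τ , τ∈ , sτ≡σ = τ , τ∈ , toWitness sτ≡σ

InImage⁺ : ∀ t n {σ τ} → τ ∈ S n → sIter t τ ≡ σ → InImage t n σ
InImage⁺ t n τ∈ sτ≡σ = any⁺ _ (lose τ∈ (fromWitness sτ≡σ))

InImage-suc⇒∷ʳ : ∀ t n {σ} → InImage (suc t) (suc n) σ → ∃ λ u → σ ≡ u ∷ʳ suc n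
InImage-suc⇒∷ʳ t n σ∈ with InImage⁻ (suc t) (suc n) σ∈
... | τ , τ∈ , refl with sIter-∈-S-suc t n τ∈
...   | ρ , _ , sτ≡ = sIter t ρ , sτ≡

InImage-suc-∷ʳ⇒InImage : ∀ t n {p} → InImage (suc t) (suc n) (p ∷ʳ suc n) → InImage t n p
InImage-suc-∷ʳ⇒InImage t n p∈ with InImage⁻ (suc t) (suc n) p∈
... | τ , τ∈ , sτ≡ with sIter-∈-S-suc t n τ∈
...   | ρ , ρ∈ , sτ≡′ = InImage⁺ t n ρ∈ (∷ʳ-injectiveˡ _ _ (trans (sym sτ≡′) sτ≡))

inImage? : ∀ t n → Decidable (InImage t n)
inImage? t n σ = T? _

module _ {A : Set} where

  length-filter-map : ∀ {B : Set} {P : Pred B 0ℓ} (P? : Decidable P) (f : A → B) xs →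
    length (filter P? (map f xs)) ≡ length (filter (P? ∘ f) xs)
  length-filter-map P? f []       = refl
  length-filter-map P? f (x ∷ xs) with does (P? (f x))
  ... | true  = cong suc (length-filter-map P? f xs)
  ... | false = length-filter-map P? f xs

  length-filter-[-]-≤ : ∀ {P Q : Pred A 0ℓ} (P? : Decidable P) (Q? : Decidable Q) {x y} →
    (P x → Q y) → length (filter P? [ x ]) ≤ length (filter Q? [ y ])
  length-filter-[-]-≤ P? Q? {x} {y} P⇒Q with P? x | Q? y
  ... | no _   | _      = z≤n
  ... | yes Px | no ¬Qy = ⊥-elim (¬Qy (P⇒Q Px))
  ... | yes _  | yes _  = ≤-refl

  length-filter-concatMap-≤ : ∀ {B : Set} {P : Pred B 0ℓ} {Q : Pred A 0ℓ}
    (P? : Decidable P) (Q? : Decidable Q) (f : A → List B) xs →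
    (∀ x → x ∈ xs → length (filter P? (f x)) ≤ length (filter Q? [ x ])) →
    length (filter P? (concatMap f xs)) ≤ length (filter Q? xs)
  length-filter-concatMap-≤ P? Q? f []       _     = z≤n
  length-filter-concatMap-≤ P? Q? f (x ∷ xs) f≤Q
    rewrite filter-++ P? (f x) (concatMap f xs) | length-++ (filter P? (f x)) {filter P? (concatMap f xs)}
          | filter-++ Q? [ x ] xs | length-++ (filter Q? [ x ]) {filter Q? xs}
    = +-mono-≤ (f≤Q x (here refl)) (length-filter-concatMap-≤ P? Q? f xs (λ y → f≤Q y ∘ there))

∉⇒≢∷ʳ : ∀ {A : Set} {x : A} {w} u → x ∉ w → w ≢ u ∷ʳ x
∉⇒≢∷ʳ u x∉w refl = x∉w (∈-++⁺ʳ u (here refl))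

-- Of the insertions of x into p, only p ∷ʳ x ends in x.
length-filter-insertions-≤ : ∀ {P : Pred (List ℕ) 0ℓ} (P? : Decidable P) x p → x ∉ p →
  (∀ {ω} → P ω → ∃ λ u → ω ≡ u ∷ʳ x) →
  length (filter P? (insertions x p)) ≤ length (filter P? [ p ∷ʳ x ])
length-filter-insertions-≤ P? x []       _   _      = ≤-refl
length-filter-insertions-≤ {P} P? x (y ∷ ys) x∉p P⇒∷ʳx = begin
  length (filter P? ((x ∷ y ∷ ys) ∷ map (y ∷_) (insertions x ys)))
    ≡⟨ cong length (filter-reject P? ¬P[x∷p]) ⟩
  length (filter P? (map (y ∷_) (insertions x ys)))
    ≡⟨ length-filter-map P? (y ∷_) (insertions x ys) ⟩
  length (filter (P? ∘ (y ∷_)) (insertions x ys))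
    ≤⟨ length-filter-insertions-≤ (P? ∘ (y ∷_)) x ys (x∉p ∘ there) P[y∷ω]⇒∷ʳx ⟩
  length (filter (P? ∘ (y ∷_)) [ ys ∷ʳ x ])
    ≡⟨ length-filter-map P? (y ∷_) [ ys ∷ʳ x ] ⟨
  length (filter P? [ y ∷ ys ∷ʳ x ]) ∎
  where
  open ≤-Reasoning
  ¬P[x∷p] : ¬ P (x ∷ y ∷ ys)
  ¬P[x∷p] Pω with P⇒∷ʳx Pω
  ... | _ ∷ u , eq = ∉⇒≢∷ʳ u x∉p (proj₂ (∷-injective eq))
  P[y∷ω]⇒∷ʳx : ∀ {ω} → P (y ∷ ω) → ∃ λ u → ω ≡ u ∷ʳ x
  P[y∷ω]⇒∷ʳx Pω with P⇒∷ʳx Pω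
  ... | []    , eq = ⊥-elim (x∉p (here (sym (proj₁ (∷-injective eq)))))
  ... | _ ∷ u , eq = u , proj₂ (∷-injective eq)

All-<⇒∉ : ∀ {x p} → All (_< x) p → x ∉ p
All-<⇒∉ p<x = All¬⇒¬Any (All.map >⇒≢ p<x)

imageSize-suc-≤ : ∀ t n → imageSize (suc t) (suc n) ≤ imageSize t n
imageSize-suc-≤ t n =
  length-filter-concatMap-≤ (inImage? (suc t) (suc n)) (inImage? t n) (insertions (suc n)) (perms n)
    λ p p∈ → ≤-trans
      (length-filter-insertions-≤ (inImage? (suc t) (suc n)) (suc n) p (All-<⇒∉ (∈-S⇒< n p∈)) (InImage-suc⇒∷ʳ t n))
      (length-filter-[-]-≤ (inImage? (suc t) (suc n)) (inImage? t n) (InImage-suc-∷ʳ⇒InImage t n))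

proposition2p6 : (m : ℕ) → 1 ≤ m → (n : ℕ) → m ≤ n →
    imageSize (suc n ∸ m) (suc n) ≤ imageSize (n ∸ m) n
proposition2p6 m _ n m≤n rewrite +-∸-assoc 1 m≤n = imageSize-suc-≤ (n ∸ m) n
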